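{- Let $n\ge 4$, let $G$ be an optimal digraph on $n$ vertices, and let $uv$ be a non-edge of $G$ of length $\alpha_G$. Then $N^+(v)\cap N^-(u)\neq\emptyset$.
   Context: Digraphs are finite and simple (no loops, no multiple edges); $2$-free means no distinct $u,v$ with both $uv,vu\in E(G)$. $N^+(v)=\{x: vx\in E(G)\}$ and $N^-(u)=\{x: xu\in E(G)\}$. A circular interval digraph is a digraph whose vertices are arranged in a (fixed) circle such that for all distinct $u,v,w$ in clockwise order, $uw\in E(G)$ implies $uv,vw\in E(G)$. For distinct vertices $u,v$ let $d(u,v)=1+|\{w: u,w,v \text{ distinct, in clockwise order}\}|$; this is the length of the ordered pair $uv$. A non-edge is an ordered pair $uv$ of distinct vertices with $uv\notin E(G)$ and $vu\notin E(G)$; its length is $d(u,v)$. $\alpha_G$ is the least length of a non-edge ($\infty$ if there is none) and $\beta_G$ the greatest length of an edge ($0$ if there is none). $\tilde{P}_3(G)$ is the number of ordered triples $(u,w,v)$ of distinct vertices with $uw,wv\in E(G)$ and neither $uv$ nor $vu$ in $E(G)$. $\xi(G)$ is the number of pairs $(uv,wx)$ where $uv\in E(G)$, $wx$ is a non-edge and $d(u,v)>d(w,x)$. For fixed $n\ge 4$, a digraph $G$ is optimal if it is a $2$-free circular interval digraph on $n$ vertices which, among all $2$-free circular interval digraphs on $n$ vertices, maximizes $\tilde{P}_3$, and subject to this minimizes $\xi$. -}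

module Defs where

open import Data.Nat using (ℕ; zero; suc; _+_; _∸_; _<_; _≤_; _<ᵇ_)
open import Data.Fin using (Fin; toℕ) renaming (zero to fzero; suc to fsuc)
import Data.Fin as F
open import Data.Bool using (Bool; true; false; if_then_else_; _∧_; not)
open import Data.Product using (_×_; ∃)
open import Data.Sum using (_⊎_)
open import Relation.Nullary using (¬_; does)
open import Relation.Binary.PropositionalEquality using (_≡_)

-- The vertices are arranged
-- on the circle in the order 0,1,...,n-1 (clockwise).
Digraph : ℕ → Set
Digraph n = Fin n → Fin n → Bool

Edge : ∀ {n} → Digraph n → Fin n → Fin n → Set
Edge E u v = E u v ≡ true

Loopless : ∀ {n} → Digraph n → Set
Loopless {n} E = (v : Fin n) → ¬ Edge E v v

TwoFree : ∀ {n} → Digraph n → Set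
TwoFree {n} E = (u v : Fin n) → ¬ (u ≡ v) → ¬ (Edge E u v × Edge E v u)

Clockwise : ∀ {n} → Fin n → Fin n → Fin n → Set
Clockwise u v w =
  (toℕ u < toℕ v × toℕ v < toℕ w) ⊎
  ((toℕ v < toℕ w × toℕ w < toℕ u) ⊎
   (toℕ w < toℕ u × toℕ u < toℕ v))

CircularInterval : ∀ {n} → Digraph n → Set
CircularInterval {n} E =
  (u v w : Fin n) → Clockwise u v w → Edge E u w → Edge E u v × Edge E v w

Admissible : ∀ {n} → Digraph n → Set
Admissible E = Loopless E × TwoFree E × CircularInterval E

-- length d(u,v) = 1 + #{w : u,w,v distinct in clockwise order}
-- (i.e. (v - u) mod n for distinct u, v)
dist : ∀ {n} → Fin n → Fin n → ℕ
dist {n} u v =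
  if toℕ u <ᵇ toℕ v then toℕ v ∸ toℕ u else n ∸ (toℕ u ∸ toℕ v)

distinctᵇ : ∀ {n} → Fin n → Fin n → Bool
distinctᵇ u v = not (does (u F.≟ v))

nonEdgeᵇ : ∀ {n} → Digraph n → Fin n → Fin n → Bool
nonEdgeᵇ E u v = distinctᵇ u v ∧ not (E u v) ∧ not (E v u)

NonEdge : ∀ {n} → Digraph n → Fin n → Fin n → Set
NonEdge E u v = nonEdgeᵇ E u v ≡ true

count : ∀ {n} → (Fin n → Bool) → ℕ
count {zero} p = 0
count {suc n} p = (if p fzero then 1 else 0) + count (λ i → p (fsuc i))

sumFin : ∀ {n} → (Fin n → ℕ) → ℕ
sumFin {zero} f = 0
sumFin {suc n} f = f fzero + sumFin (λ i → f (fsuc i))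

P3 : ∀ {n} → Digraph n → ℕ
P3 E = sumFin λ u → sumFin λ w → count λ v →
  distinctᵇ u w ∧ distinctᵇ w v ∧ distinctᵇ u v ∧
  E u w ∧ E w v ∧ not (E u v) ∧ not (E v u)

xi : ∀ {n} → Digraph n → ℕ
xi E = sumFin λ u → sumFin λ v → sumFin λ w → count λ x →
  E u v ∧ nonEdgeᵇ E w x ∧ (dist w x <ᵇ dist u v)

Optimal : ∀ {n} → Digraph n → Set
Optimal {n} G =
  Admissible G ×
  ((H : Digraph n) → Admissible H →
     (P3 H ≤ P3 G) × (P3 H ≡ P3 G → xi G ≤ xi H))

MinNonEdge : ∀ {n} → Digraph n → Fin n → Fin n → Set
MinNonEdge {n} G u v =
  NonEdge G u v × ((w x : Fin n) → NonEdge G w x → dist u v ≤ dist w x)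

-- Suppose there is no such x and let H = G + uv.  Minimality of α makes every
-- pair at distance < α adjacent, and from this H is again a 2-free circular
-- interval digraph.  Comparing induced 2-paths, H gains (p,u,v) for every
-- in-neighbour p of u non-adjacent to v and (u,v,q) for every out-neighbour q
-- of v non-adjacent to u, and loses only the (u,w,v); reflecting w in u maps
-- the lost middles injectively into the first kind of gain, so
--   P̃₃(G) + #{q : v → q, q ≁ u} ≤ P̃₃(H).
-- Optimality of G then forces, in turn:
--   (1) v has no out-neighbour (otherwise P̃₃(H) > P̃₃(G));
--   (2) no edge is longer than α (otherwise ξ(H) < ξ(G) while P̃₃(H) = P̃₃(G));
--   (3) α ≤ 1 (otherwise the successor s of v gives an edge sv of length n-1 > α);
--   (4) impossible: all edges have length ≤ 1 and v is a sink, so P̃₃(G) < n,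
--       while the directed Hamiltonian cycle C has P̃₃(C) ≥ n.
module Submission where

open import Defs

open import Data.Nat
open import Data.Nat.Properties
open import Data.Bool using (Bool; true; false; if_then_else_; _∧_; not; _∨_)
open import Data.Bool.Properties using (∨-identityʳ; T-≡)
import Data.Bool as B
open import Data.Fin using (Fin; toℕ) renaming (zero to fzero; suc to fsuc)
import Data.Fin as F
import Data.Fin.Properties as FP
open import Data.Fin.Permutation using (permutation)
import Algebra.Properties.CommutativeMonoid.Sum as CommSum
open import Algebra.Properties.CommutativeSemigroup +-commutativeSemigroup using (interchange; xy∙z≈xz∙y)
open import Data.Product
open import Data.Sum
open import Data.Empty
open import Function.Bundles using (Equivalence)
open import Relation.Nullary
open import Relation.Nullary.Decidable using (_×-dec_; dec-true; dec-false)
open import Relation.Binary.Definitions using (tri<; tri≈; tri>)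
open import Relation.Binary.PropositionalEquality

t≢f : true ≢ false
t≢f ()

clash : ∀ {b} {A : Set} → b ≡ true → b ≡ false → A
clash e1 e2 = ⊥-elim (t≢f (trans (sym e1) e2))

¬true⇒false : ∀ {b} → ¬ (b ≡ true) → b ≡ false
¬true⇒false {false} _ = refl
¬true⇒false {true} h = ⊥-elim (h refl)

∧-I : ∀ {a b} → a ≡ true → b ≡ true → a ∧ b ≡ true
∧-I refl refl = refl

∧-E : ∀ a {b} → a ∧ b ≡ true → a ≡ true × b ≡ true
∧-E true e = refl , e

not-I : ∀ {b} → b ≡ false → not b ≡ true
not-I refl = refl

not-E : ∀ {b} → not b ≡ true → b ≡ false
not-E {false} _ = refl

_==_ : ∀ {n} → Fin n → Fin n → Bool
x == y = does (x F.≟ y)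

==-refl : ∀ {n} (x : Fin n) → (x == x) ≡ true
==-refl x = dec-true (x F.≟ x) refl

==-sound : ∀ {n} {x y : Fin n} → (x == y) ≡ true → x ≡ y
==-sound {x = x} {y} e with x F.≟ y
... | yes x≡y = x≡y
... | no _ = ⊥-elim (t≢f (sym e))

located : ∀ {n} (x a y b : Fin n) c → ((x == a) ∧ (y == b) ∧ c) ≡ true →
  x ≡ a × y ≡ b × c ≡ true
located x a y b c e =
  let (xa , r) = ∧-E (x == a) e
      (yb , c≡true) = ∧-E (y == b) r
  in ==-sound xa , ==-sound yb , c≡true

circ : ℕ → ℕ → ℕ → ℕ
circ n a b = if a <ᵇ b then b ∸ a else n ∸ (a ∸ b)

<ᵇ-true : ∀ {a b} → a < b → (a <ᵇ b) ≡ true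
<ᵇ-true a<b = Equivalence.to T-≡ (<⇒<ᵇ a<b)

<ᵇ-false : ∀ {a b} → b ≤ a → (a <ᵇ b) ≡ false
<ᵇ-false {a} {b} b≤a = ¬true⇒false (λ t → <⇒≱ (<ᵇ⇒< a b (Equivalence.from T-≡ t)) b≤a)

<ᵇ-false⇒≥ : ∀ {a b} → (a <ᵇ b) ≡ false → b ≤ a
<ᵇ-false⇒≥ e = ≮⇒≥ (λ a<b → t≢f (trans (sym (<ᵇ-true a<b)) e))

circ-lt : ∀ n a b → a < b → a + circ n a b ≡ b
circ-lt n a b a<b rewrite <ᵇ-true a<b = m+[n∸m]≡n (<⇒≤ a<b)

circ-ge : ∀ n a b → a < n → b ≤ a → b + n ≡ a + circ n a b
circ-ge n a b a<n b≤a rewrite <ᵇ-false b≤a = begin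
  b + n                          ≡⟨ cong (b +_) (sym (m+[n∸m]≡n a∸b≤n)) ⟩
  b + ((a ∸ b) + (n ∸ (a ∸ b)))  ≡⟨ sym (+-assoc b _ _) ⟩
  (b + (a ∸ b)) + (n ∸ (a ∸ b))  ≡⟨ cong (_+ (n ∸ (a ∸ b))) (m+[n∸m]≡n b≤a) ⟩
  a + (n ∸ (a ∸ b))              ∎
  where
  open ≡-Reasoning
  a∸b≤n : a ∸ b ≤ n
  a∸b≤n = ≤-trans (m∸n≤m a b) (<⇒≤ a<n)

circ-spec : ∀ n a b → a < n →
  (a < b × a + circ n a b ≡ b) ⊎ (b ≤ a × b + n ≡ a + circ n a b)
circ-spec n a b a<n with a <? b
... | yes a<b = inj₁ (a<b , circ-lt n a b a<b)
... | no a≮b = inj₂ (≮⇒≥ a≮b , circ-ge n a b a<n (≮⇒≥ a≮b))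

circ-pos : ∀ n a b → a < n → 0 < circ n a b
circ-pos n a b a<n = n≢0⇒n>0 (nonzero (circ-spec n a b a<n))
  where
  nonzero : (a < b × a + circ n a b ≡ b) ⊎ (b ≤ a × b + n ≡ a + circ n a b) →
            circ n a b ≢ 0
  nonzero (inj₁ (a<b , e)) c≡0 =
    <-irrefl (trans (sym (+-identityʳ a)) (trans (cong (a +_) (sym c≡0)) e)) a<b
  nonzero (inj₂ (_ , e)) c≡0 =
    <⇒≱ a<n (subst (n ≤_) (trans e (trans (cong (a +_) c≡0) (+-identityʳ a))) (m≤n+m n b))

circ-≤ : ∀ n a b → a < n → b < n → circ n a b ≤ n
circ-≤ n a b a<n b<n with circ-spec n a b a<n
... | inj₁ (_ , e) = <⇒≤ (≤-trans (s≤s (m≤n+m (circ n a b) a)) (subst (_< n) (sym e) b<n))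
... | inj₂ (b≤a , e) = +-cancelˡ-≤ a _ _ (subst (_≤ a + n) e (+-monoˡ-≤ n b≤a))

circ-self : ∀ n a → circ n a a ≡ n
circ-self n a rewrite <ᵇ-false {a} {a} ≤-refl | n∸n≡0 a = refl

circ-sum : ∀ n a b → a < n → b < n → a ≢ b → circ n a b + circ n b a ≡ n
circ-sum n a b a<n b<n a≢b with <-cmp a b
... | tri≈ _ a≡b _ = ⊥-elim (a≢b a≡b)
... | tri< a<b _ _ = +-cancelˡ-≡ a _ _ (begin
    a + (circ n a b + circ n b a) ≡⟨ sym (+-assoc a _ _) ⟩
    (a + circ n a b) + circ n b a ≡⟨ cong (_+ circ n b a) (circ-lt n a b a<b) ⟩
    b + circ n b a                ≡⟨ sym (circ-ge n b a b<n (<⇒≤ a<b)) ⟩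
    a + n                         ∎)
  where open ≡-Reasoning
... | tri> _ _ b<a = +-cancelˡ-≡ b _ _ (begin
    b + (circ n a b + circ n b a) ≡⟨ cong (b +_) (+-comm (circ n a b) _) ⟩
    b + (circ n b a + circ n a b) ≡⟨ sym (+-assoc b _ _) ⟩
    (b + circ n b a) + circ n a b ≡⟨ cong (_+ circ n a b) (circ-lt n b a b<a) ⟩
    a + circ n a b                ≡⟨ sym (circ-ge n a b a<n (<⇒≤ b<a)) ⟩
    b + n                         ∎)
  where open ≡-Reasoning

circ-injective : ∀ n a b c → a < n → b < n → c < n → circ n a b ≡ circ n a c → b ≡ c
circ-injective n a b c a<n b<n c<n e with circ-spec n a b a<n | circ-spec n a c a<n
... | inj₁ (_ , e₁) | inj₁ (_ , e₂) = trans (sym e₁) (trans (cong (a +_) e) e₂)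
... | inj₁ (_ , e₁) | inj₂ (_ , e₂) =
  ⊥-elim (<⇒≱ b<n (subst (n ≤_) (trans e₂ (trans (cong (a +_) (sym e)) e₁)) (m≤n+m n c)))
... | inj₂ (_ , e₁) | inj₁ (_ , e₂) =
  ⊥-elim (<⇒≱ c<n (subst (n ≤_) (trans e₁ (trans (cong (a +_) e) e₂)) (m≤n+m n b)))
... | inj₂ (_ , e₁) | inj₂ (_ , e₂) = +-cancelʳ-≡ n b c (trans e₁ (trans (cong (a +_) e) (sym e₂)))

cw : ℕ → ℕ → ℕ → Set
cw a b c = (a < b × b < c) ⊎ ((b < c × c < a) ⊎ (c < a × a < b))

cw-either : ∀ a b c → a ≢ b → b ≢ c → a ≢ c → cw a b c ⊎ cw a c b
cw-either a b c a≢b b≢c a≢c with <-cmp a b | <-cmp b c | <-cmp a c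
... | tri≈ _ e _ | _ | _ = ⊥-elim (a≢b e)
... | _ | tri≈ _ e _ | _ = ⊥-elim (b≢c e)
... | _ | _ | tri≈ _ e _ = ⊥-elim (a≢c e)
... | tri< x _ _ | tri< y _ _ | _ = inj₁ (inj₁ (x , y))
... | tri< x _ _ | tri> _ _ y | tri< z _ _ = inj₂ (inj₁ (z , y))
... | tri< x _ _ | tri> _ _ y | tri> _ _ z = inj₁ (inj₂ (inj₂ (z , x)))
... | tri> _ _ x | tri< y _ _ | tri< z _ _ = inj₂ (inj₂ (inj₂ (x , z)))
... | tri> _ _ x | tri< y _ _ | tri> _ _ z = inj₁ (inj₂ (inj₁ (y , z)))
... | tri> _ _ x | tri> _ _ y | _ = inj₂ (inj₂ (inj₁ (y , x)))

circ-add : ∀ n a b c → a < n → b < n → c < n → cw a b c →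
  circ n a b + circ n b c ≡ circ n a c
circ-add n a b c a<n b<n c<n (inj₁ (a<b , b<c)) = +-cancelˡ-≡ a _ _ (begin
    a + (circ n a b + circ n b c) ≡⟨ sym (+-assoc a _ _) ⟩
    (a + circ n a b) + circ n b c ≡⟨ cong (_+ circ n b c) (circ-lt n a b a<b) ⟩
    b + circ n b c                ≡⟨ circ-lt n b c b<c ⟩
    c                             ≡⟨ sym (circ-lt n a c (<-trans a<b b<c)) ⟩
    a + circ n a c                ∎)
  where open ≡-Reasoning
circ-add n a b c a<n b<n c<n (inj₂ (inj₁ (b<c , c<a))) = +-cancelˡ-≡ a _ _ (begin
    a + (circ n a b + circ n b c) ≡⟨ sym (+-assoc a _ _) ⟩
    (a + circ n a b) + circ n b c ≡⟨ cong (_+ circ n b c) (sym (circ-ge n a b a<n b≤a)) ⟩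
    (b + n) + circ n b c          ≡⟨ +-assoc b n _ ⟩
    b + (n + circ n b c)          ≡⟨ cong (b +_) (+-comm n _) ⟩
    b + (circ n b c + n)          ≡⟨ sym (+-assoc b _ n) ⟩
    (b + circ n b c) + n          ≡⟨ cong (_+ n) (circ-lt n b c b<c) ⟩
    c + n                         ≡⟨ circ-ge n a c a<n (<⇒≤ c<a) ⟩
    a + circ n a c                ∎)
  where
  open ≡-Reasoning
  b≤a : b ≤ a
  b≤a = <⇒≤ (<-trans b<c c<a)
circ-add n a b c a<n b<n c<n (inj₂ (inj₂ (c<a , a<b))) = +-cancelˡ-≡ a _ _ (begin
    a + (circ n a b + circ n b c) ≡⟨ sym (+-assoc a _ _) ⟩
    (a + circ n a b) + circ n b c ≡⟨ cong (_+ circ n b c) (circ-lt n a b a<b) ⟩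
    b + circ n b c                ≡⟨ sym (circ-ge n b c b<n (<⇒≤ (<-trans c<a a<b))) ⟩
    c + n                         ≡⟨ circ-ge n a c a<n (<⇒≤ c<a) ⟩
    a + circ n a c                ∎)
  where open ≡-Reasoning

shift : ℕ → ℕ → ℕ → ℕ
shift n a k = if a + k <ᵇ n then a + k else a + k ∸ n

shift-< : ∀ n a k → a < n → k ≤ n → shift n a k < n
shift-< n a k a<n k≤n with a + k <ᵇ n in eq
... | true = <ᵇ⇒< (a + k) n (Equivalence.from T-≡ eq)
... | false = +-cancelʳ-< _ _ n (begin-strict
      (a + k ∸ n) + n ≡⟨ m∸n+n≡m {a + k} {n} (<ᵇ-false⇒≥ eq) ⟩
      a + k           <⟨ +-monoˡ-< k a<n ⟩
      n + k           ≤⟨ +-monoʳ-≤ n k≤n ⟩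
      n + n           ∎)
  where open ≤-Reasoning

circ-shift : ∀ n a k → a < n → 0 < k → k ≤ n → circ n a (shift n a k) ≡ k
circ-shift n a k a<n 0<k k≤n with a + k <ᵇ n in eq
... | true = +-cancelˡ-≡ a _ _ (circ-lt n a (a + k) (m<m+n a 0<k))
... | false = +-cancelˡ-≡ a _ _
      (trans (sym (circ-ge n a (a + k ∸ n) a<n wrapped≤a)) (m∸n+n≡m {a + k} {n} n≤a+k))
  where
  n≤a+k : n ≤ a + k
  n≤a+k = <ᵇ-false⇒≥ eq
  wrapped≤a : a + k ∸ n ≤ a
  wrapped≤a = +-cancelʳ-≤ n _ a (begin
      (a + k ∸ n) + n ≡⟨ m∸n+n≡m {a + k} {n} n≤a+k ⟩
      a + k           ≤⟨ +-monoʳ-≤ a k≤n ⟩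
      a + n           ∎)
    where open ≤-Reasoning

shift-zero : ∀ n a → a < n → shift n a 0 ≡ a
shift-zero n a a<n rewrite +-identityʳ a | <ᵇ-true a<n = refl

ind : Bool → ℕ
ind b = if b then 1 else 0

ind-∧ : ∀ a b → ind (a ∧ b) ≡ (if a then ind b else 0)
ind-∧ false b = refl
ind-∧ true b = refl

ind-mono : ∀ {a b} → (a ≡ true → b ≡ true) → ind a ≤ ind b
ind-mono {false} h = z≤n
ind-mono {true} h rewrite h refl = ≤-refl

-- The counting principle behind the comparison of G with G + uv, for one
-- ordered triple: a (an old triple), b and c (new triples of two kinds) are
-- mutually exclusive, b and c imply d (a triple of the new digraph), and a
-- implies d unless it is compensated by e (a destroyed triple).
exchange : ∀ a b c d e → (a ≡ true → e ≡ false → d ≡ true) → (b ≡ true → d ≡ true) →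
  (c ≡ true → d ≡ true) → (a ≡ true → b ≡ false) → (a ≡ true → c ≡ false) →
  (b ≡ true → c ≡ false) → ind a + ind b + ind c ≤ ind d + ind e
exchange false false false d     e     _  _  _  _  _  _  = z≤n
exchange false false true  true  e     _  _  _  _  _  _  = s≤s z≤n
exchange false false true  false e     _  _  cd _  _  _  = ⊥-elim (t≢f (sym (cd refl)))
exchange false true  false true  e     _  _  _  _  _  _  = s≤s z≤n
exchange false true  false false e     _  bd _  _  _  _  = ⊥-elim (t≢f (sym (bd refl)))
exchange false true  true  d     e     _  _  _  _  _  bc = ⊥-elim (t≢f (bc refl))
exchange true  true  c     d     e     _  _  _  ab _  _  = ⊥-elim (t≢f (ab refl))
exchange true  false true  d     e     _  _  _  _  ac _  = ⊥-elim (t≢f (ac refl))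
exchange true  false false d     true  _  _  _  _  _  _  = m≤n+m 1 (ind d)
exchange true  false false true  false _  _  _  _  _  _  = s≤s z≤n
exchange true  false false false false ad _  _  _  _  _  = ⊥-elim (t≢f (sym (ad refl refl)))

sum-cong : ∀ {n} {f g : Fin n → ℕ} → (∀ i → f i ≡ g i) → sumFin f ≡ sumFin g
sum-cong {zero} h = refl
sum-cong {suc n} h = cong₂ _+_ (h fzero) (sum-cong (λ i → h (fsuc i)))

sum-mono : ∀ {n} {f g : Fin n → ℕ} → (∀ i → f i ≤ g i) → sumFin f ≤ sumFin g
sum-mono {zero} h = z≤n
sum-mono {suc n} h = +-mono-≤ (h fzero) (sum-mono (λ i → h (fsuc i)))

sum-strict : ∀ {n} {f g : Fin n → ℕ} → (∀ i → f i ≤ g i) → ∀ j → f j < g j →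
  sumFin f < sumFin g
sum-strict {suc n} h fzero lt = +-mono-<-≤ lt (sum-mono (λ i → h (fsuc i)))
sum-strict {suc n} h (fsuc j) lt = +-mono-≤-< (h fzero) (sum-strict (λ i → h (fsuc i)) j lt)

sum-+ : ∀ {n} (f g : Fin n → ℕ) → sumFin (λ i → f i + g i) ≡ sumFin f + sumFin g
sum-+ {zero} f g = refl
sum-+ {suc n} f g = trans
  (cong ((f fzero + g fzero) +_) (sum-+ (λ i → f (fsuc i)) (λ i → g (fsuc i))))
  (interchange (f fzero) (g fzero) _ _)

sum-zero : ∀ {n} → sumFin {n} (λ _ → 0) ≡ 0
sum-zero {zero} = refl
sum-zero {suc n} = sum-zero {n}

sum-one : ∀ {n} → sumFin {n} (λ _ → 1) ≡ n
sum-one {zero} = refl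
sum-one {suc n} = cong suc (sum-one {n})

sum-≥ : ∀ {n} (f : Fin n → ℕ) j → f j ≤ sumFin f
sum-≥ {suc n} f fzero = m≤m+n _ _
sum-≥ {suc n} f (fsuc j) = ≤-trans (sum-≥ (λ i → f (fsuc i)) j) (m≤n+m _ _)

sum-guard : ∀ {n} (b : Bool) (f : Fin n → ℕ) →
  sumFin (λ i → if b then f i else 0) ≡ (if b then sumFin f else 0)
sum-guard true f = refl
sum-guard {n} false f = sum-zero {n}

guard-cong : ∀ (b : Bool) {x y : ℕ} → x ≡ y → (if b then x else 0) ≡ (if b then y else 0)
guard-cong b = cong (λ m → if b then m else 0)

sum-point : ∀ {n} (c : Fin n) (f : Fin n → ℕ) → sumFin (λ i → if i == c then f i else 0) ≡ f c
sum-point {suc n} fzero f = trans (cong (f fzero +_) (sum-zero {n})) (+-identityʳ _)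
sum-point {suc n} (fsuc c) f = sum-point c (λ i → f (fsuc i))

sum-guarded : ∀ {n} (b : Bool) (f : Fin n → Bool) →
  sumFin (λ i → ind (b ∧ f i)) ≡ (if b then sumFin (λ i → ind (f i)) else 0)
sum-guarded true f = refl
sum-guarded {n} false f = sum-zero {n}

sum-at : ∀ {n} (c : Fin n) (f : Fin n → Bool) → sumFin (λ i → ind ((i == c) ∧ f i)) ≡ ind (f c)
sum-at c f = trans (sum-cong (λ i → ind-∧ (i == c) (f i))) (sum-point c (λ i → ind (f i)))

sum-involution : ∀ {n} (r : Fin n → Fin n) → (∀ x → r (r x) ≡ x) → (f : Fin n → ℕ) →
  sumFin f ≡ sumFin (λ i → f (r i))
sum-involution r r∘r f = trans (as-sum f)
  (trans (sum-permute f (permutation r r r∘r r∘r)) (sym (as-sum (λ i → f (r i)))))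
  where
  open CommSum +-0-commutativeMonoid using (sum; sum-permute)
  as-sum : ∀ {n} (g : Fin n → ℕ) → sumFin g ≡ sum g
  as-sum {zero} g = refl
  as-sum {suc n} g = cong (g fzero +_) (as-sum (λ i → g (fsuc i)))

count≡sum : ∀ {n} (p : Fin n → Bool) → count p ≡ sumFin (λ i → ind (p i))
count≡sum {zero} p = refl
count≡sum {suc n} p = cong (ind (p fzero) +_) (count≡sum (λ i → p (fsuc i)))

count-mono : ∀ {n} {p q : Fin n → Bool} → (∀ i → p i ≡ true → q i ≡ true) → count p ≤ count q
count-mono {p = p} {q} h = subst₂ _≤_ (sym (count≡sum p)) (sym (count≡sum q))
  (sum-mono (λ i → ind-mono (h i)))

count-strict : ∀ {n} {p q : Fin n → Bool} → (∀ i → p i ≡ true → q i ≡ true) →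
  ∀ j → p j ≡ false → q j ≡ true → count p < count q
count-strict {p = p} {q} h j pj qj = subst₂ _<_ (sym (count≡sum p)) (sym (count≡sum q))
  (sum-strict (λ i → ind-mono (h i)) j (subst₂ (λ x y → ind x < ind y) (sym pj) (sym qj) z<s))

count-≥1 : ∀ {n} (p : Fin n → Bool) (j : Fin n) → p j ≡ true → 1 ≤ count p
count-≥1 p j e = subst (1 ≤_) (sym (count≡sum p))
  (subst (λ b → ind b ≤ sumFin (λ i → ind (p i))) e (sum-≥ (λ i → ind (p i)) j))

count-zero : ∀ {n} (p : Fin n → Bool) → (∀ i → p i ≡ false) → count p ≡ 0
count-zero {n} p h = trans (count≡sum p) (trans (sum-cong (λ i → cong ind (h i))) (sum-zero {n}))

sum3 : ∀ {n} → (Fin n → Fin n → Fin n → ℕ) → ℕ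
sum3 F = sumFin (λ p → sumFin (λ w → sumFin (λ q → F p w q)))

sum3-+ : ∀ {n} (F K : Fin n → Fin n → Fin n → ℕ) →
  sum3 (λ p w q → F p w q + K p w q) ≡ sum3 F + sum3 K
sum3-+ F K = trans
  (sum-cong (λ p → trans (sum-cong (λ w → sum-+ (F p w) (K p w)))
                         (sum-+ (λ w → sumFin (F p w)) (λ w → sumFin (K p w)))))
  (sum-+ (λ p → sumFin (λ w → sumFin (F p w))) (λ p → sumFin (λ w → sumFin (K p w))))

sum3-mono : ∀ {n} {F K : Fin n → Fin n → Fin n → ℕ} → (∀ p w q → F p w q ≤ K p w q) →
  sum3 F ≤ sum3 K
sum3-mono h = sum-mono (λ p → sum-mono (λ w → sum-mono (λ q → h p w q)))

count4 : ∀ {n} → (Fin n → Fin n → Fin n → Fin n → Bool) → ℕ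
count4 F = sumFin (λ p → sumFin (λ q → sumFin (λ w → count (F p q w))))

count4-strict : ∀ {n} {F K : Fin n → Fin n → Fin n → Fin n → Bool} →
  (∀ p q w x → F p q w x ≡ true → K p q w x ≡ true) →
  ∀ p q w x → F p q w x ≡ false → K p q w x ≡ true → count4 F < count4 K
count4-strict F⊆K p q w x Fx Kx =
  sum-strict (λ p → sum-mono (λ q → sum-mono (λ w → count-mono (F⊆K p q w)))) p
    (sum-strict (λ q → sum-mono (λ w → count-mono (F⊆K p q w))) q
      (sum-strict (λ w → count-mono (F⊆K p q w)) w
        (count-strict (F⊆K p q w) x Fx Kx)))

module _ {n : ℕ} where
  private
    <n : (x : Fin n) → toℕ x < n
    <n = FP.toℕ<n

    ≢-toℕ : {x y : Fin n} → x ≢ y → toℕ x ≢ toℕ y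
    ≢-toℕ x≢y e = x≢y (FP.toℕ-injective e)

  dist-pos : (x y : Fin n) → 0 < dist x y
  dist-pos x y = circ-pos n (toℕ x) (toℕ y) (<n x)

  dist-≤ : (x y : Fin n) → dist x y ≤ n
  dist-≤ x y = circ-≤ n (toℕ x) (toℕ y) (<n x) (<n y)

  dist-self : (x : Fin n) → dist x x ≡ n
  dist-self x = circ-self n (toℕ x)

  dist-sum : {x y : Fin n} → x ≢ y → dist x y + dist y x ≡ n
  dist-sum {x} {y} x≢y = circ-sum n (toℕ x) (toℕ y) (<n x) (<n y) (≢-toℕ x≢y)

  dist-< : {x y : Fin n} → x ≢ y → dist x y < n
  dist-< {x} {y} x≢y = subst (dist x y <_) (dist-sum x≢y) (m<m+n _ (dist-pos y x))

  dist-injective : (x y z : Fin n) → dist x y ≡ dist x z → y ≡ z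
  dist-injective x y z e =
    FP.toℕ-injective (circ-injective n (toℕ x) (toℕ y) (toℕ z) (<n x) (<n y) (<n z) e)

  dist-add : {x y z : Fin n} → Clockwise x y z → dist x y + dist y z ≡ dist x z
  dist-add {x} {y} {z} c = circ-add n (toℕ x) (toℕ y) (toℕ z) (<n x) (<n y) (<n z) c

  clockwise-either : {x y z : Fin n} → x ≢ y → y ≢ z → x ≢ z →
    Clockwise x y z ⊎ Clockwise x z y
  clockwise-either {x} {y} {z} x≢y y≢z x≢z =
    cw-either (toℕ x) (toℕ y) (toℕ z) (≢-toℕ x≢y) (≢-toℕ y≢z) (≢-toℕ x≢z)

  clockwise-rotate : {x y z : Fin n} → Clockwise x y z → Clockwise y z x
  clockwise-rotate (inj₁ x) = inj₂ (inj₂ x)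
  clockwise-rotate (inj₂ (inj₁ x)) = inj₁ x
  clockwise-rotate (inj₂ (inj₂ x)) = inj₂ (inj₁ x)

  clockwise-<₁ : {x y z : Fin n} → Clockwise x y z → dist x y < dist x z
  clockwise-<₁ {x} {y} {z} c = subst (dist x y <_) (dist-add c) (m<m+n _ (dist-pos y z))

  clockwise-<₂ : {x y z : Fin n} → Clockwise x y z → dist y z < dist x z
  clockwise-<₂ {x} {y} {z} c = subst (dist y z <_) (dist-add c) (m<n+m _ (dist-pos x y))

  clockwise-≢₁ : {x y z : Fin n} → Clockwise x y z → x ≢ y
  clockwise-≢₁ {x} {y} {z} c refl =
    <⇒≱ (clockwise-<₁ c) (subst (dist x z ≤_) (sym (dist-self x)) (dist-≤ x z))

  clockwise-≢₂ : {x y z : Fin n} → Clockwise x y z → y ≢ z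
  clockwise-≢₂ c = clockwise-≢₁ (clockwise-rotate c)

  step : (x : Fin n) (k : ℕ) → k ≤ n → Fin n
  step x k k≤n = F.fromℕ< (shift-< n (toℕ x) k (<n x) k≤n)

  dist-step : (x : Fin n) (k : ℕ) (k≤n : k ≤ n) → 0 < k → dist x (step x k k≤n) ≡ k
  dist-step x k k≤n 0<k rewrite FP.toℕ-fromℕ< (shift-< n (toℕ x) k (<n x) k≤n) =
    circ-shift n (toℕ x) k (<n x) 0<k k≤n

  step-zero : (x : Fin n) (k : ℕ) (k≤n : k ≤ n) → k ≡ 0 → step x k k≤n ≡ x
  step-zero x .0 k≤n refl = FP.toℕ-injective
    (trans (FP.toℕ-fromℕ< (shift-< n (toℕ x) 0 (<n x) k≤n)) (shift-zero n (toℕ x) (<n x)))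

  next : Fin n → Fin n
  next x = step x 1 (≤-trans (s≤s z≤n) (<n x))

  dist-next : (x : Fin n) → dist x (next x) ≡ 1
  dist-next x = dist-step x 1 (≤-trans (s≤s z≤n) (<n x)) z<s

  next-≢ : 1 < n → (x : Fin n) → x ≢ next x
  next-≢ 1<n x e =
    <⇒≢ 1<n (sym (trans (sym (dist-self x)) (trans (cong (dist x) e) (dist-next x))))

  dist-1⇒next : (x y : Fin n) → dist x y ≡ 1 → y ≡ next x
  dist-1⇒next x y e = dist-injective x y (next x) (trans e (sym (dist-next x)))

  module Reflection (c : Fin n) where
    reflect : Fin n → Fin n
    reflect x = step c (n ∸ dist c x) (m∸n≤m n (dist c x))

    dist-reflect : (x : Fin n) → x ≢ c → dist c (reflect x) ≡ n ∸ dist c x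
    dist-reflect x x≢c = dist-step c (n ∸ dist c x) (m∸n≤m n (dist c x))
      (m<n⇒0<n∸m (dist-< (λ e → x≢c (sym e))))

    reflect-fixed : reflect c ≡ c
    reflect-fixed = step-zero c (n ∸ dist c c) (m∸n≤m n (dist c c))
      (trans (cong (n ∸_) (dist-self c)) (n∸n≡0 n))

    reflect-≢ : (x : Fin n) → x ≢ c → reflect x ≢ c
    reflect-≢ x x≢c e = <-irrefl (sym (trans (sym (dist-self c))
        (trans (cong (dist c) (sym e)) (dist-reflect x x≢c))))
      (∸-monoʳ-< {n} {dist c x} {0} (dist-pos c x) (dist-≤ c x))

    dist-to-reflect : (x : Fin n) → x ≢ c → dist (reflect x) c ≡ dist c x
    dist-to-reflect x x≢c = begin
      dist (reflect x) c               ≡⟨ sym (m+n∸m≡n (dist c (reflect x)) _) ⟩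
      (dist c (reflect x) + dist (reflect x) c) ∸ dist c (reflect x)
        ≡⟨ cong (_∸ dist c (reflect x)) (dist-sum (λ e → reflect-≢ x x≢c (sym e))) ⟩
      n ∸ dist c (reflect x)           ≡⟨ cong (n ∸_) (dist-reflect x x≢c) ⟩
      n ∸ (n ∸ dist c x)               ≡⟨ m∸[m∸n]≡n (dist-≤ c x) ⟩
      dist c x                         ∎
      where open ≡-Reasoning

    reflect-involutive : (x : Fin n) → reflect (reflect x) ≡ x
    reflect-involutive x with x F.≟ c
    ... | yes refl = trans (cong reflect reflect-fixed) reflect-fixed
    ... | no x≢c = dist-injective c _ _ (begin
      dist c (reflect (reflect x)) ≡⟨ dist-reflect (reflect x) (reflect-≢ x x≢c) ⟩
      n ∸ dist c (reflect x)       ≡⟨ cong (n ∸_) (dist-reflect x x≢c) ⟩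
      n ∸ (n ∸ dist c x)           ≡⟨ m∸[m∸n]≡n (dist-≤ c x) ⟩
      dist c x                     ∎)
      where open ≡-Reasoning

module _ {n : ℕ} where
  distinct-I : {x y : Fin n} → x ≢ y → distinctᵇ x y ≡ true
  distinct-I {x} {y} x≢y = cong not (dec-false (x F.≟ y) x≢y)

  distinct-E : {x y : Fin n} → distinctᵇ x y ≡ true → x ≢ y
  distinct-E {x} {y} d x≡y = t≢f (trans (sym d) (cong not (dec-true (x F.≟ y) x≡y)))

  nonEdge-E : (E : Digraph n) {w x : Fin n} → NonEdge E w x →
    (w ≢ x) × (E w x ≡ false) × (E x w ≡ false)
  nonEdge-E E {w} {x} ne =
    let (d , r) = ∧-E (distinctᵇ w x) ne
        (e₁ , e₂) = ∧-E (not (E w x)) r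
    in distinct-E d , not-E e₁ , not-E e₂

  nonEdge-I : (E : Digraph n) {w x : Fin n} → w ≢ x → E w x ≡ false → E x w ≡ false →
    NonEdge E w x
  nonEdge-I E d e₁ e₂ = ∧-I (distinct-I d) (∧-I (not-I e₁) (not-I e₂))

  tri : Digraph n → Fin n → Fin n → Fin n → Bool
  tri E p w q = distinctᵇ p w ∧ distinctᵇ w q ∧ distinctᵇ p q ∧
                E p w ∧ E w q ∧ not (E p q) ∧ not (E q p)

  record Triple (E : Digraph n) (p w q : Fin n) : Set where
    field
      p≢w : p ≢ w
      w≢q : w ≢ q
      p≢q : p ≢ q
      pw  : E p w ≡ true
      wq  : E w q ≡ true
      ¬pq : E p q ≡ false
      ¬qp : E q p ≡ false

  tri-E : (E : Digraph n) (p w q : Fin n) → tri E p w q ≡ true → Triple E p w q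
  tri-E E p w q t =
    let (d₁ , t₁) = ∧-E (distinctᵇ p w) t
        (d₂ , t₂) = ∧-E (distinctᵇ w q) t₁
        (d₃ , t₃) = ∧-E (distinctᵇ p q) t₂
        (e₁ , t₄) = ∧-E (E p w) t₃
        (e₂ , t₅) = ∧-E (E w q) t₄
        (e₃ , e₄) = ∧-E (not (E p q)) t₅
    in record { p≢w = distinct-E d₁ ; w≢q = distinct-E d₂ ; p≢q = distinct-E d₃
              ; pw = e₁ ; wq = e₂ ; ¬pq = not-E e₃ ; ¬qp = not-E e₄ }

  tri-I : (E : Digraph n) {p w q : Fin n} → Triple E p w q → tri E p w q ≡ true
  tri-I E t = ∧-I (distinct-I p≢w) (∧-I (distinct-I w≢q) (∧-I (distinct-I p≢q)
    (∧-I pw (∧-I wq (∧-I (not-I ¬pq) (not-I ¬qp))))))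
    where open Triple t

  P3-as-sum3 : (E : Digraph n) → P3 E ≡ sum3 (λ p w q → ind (tri E p w q))
  P3-as-sum3 E = sum-cong (λ p → sum-cong (λ w → count≡sum (tri E p w)))

  longer : Digraph n → Fin n → Fin n → Fin n → Fin n → Bool
  longer E p q w x = E p q ∧ nonEdgeᵇ E w x ∧ (dist w x <ᵇ dist p q)

module _ {n : ℕ} {G : Digraph n} (opt : Optimal G) where
  P3-maximal : (H : Digraph n) → Admissible H → P3 H ≤ P3 G
  P3-maximal H adm = proj₁ (proj₂ opt H adm)

  xi-minimal : (H : Digraph n) → Admissible H → P3 H ≡ P3 G → xi G ≤ xi H
  xi-minimal H adm = proj₂ (proj₂ opt H adm)

module Cycle (n : ℕ) (4≤n : 4 ≤ n) where
  C : Digraph n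
  C p q = dist p q ≡ᵇ 1

  private
    n≢ : ∀ {k} → k < 4 → n ≢ k
    n≢ k<4 n≡k = <⇒≱ k<4 (subst (4 ≤_) n≡k 4≤n)

    n≢1 : n ≢ 1
    n≢1 = n≢ (s≤s (s≤s z≤n))

    1<n : 1 < n
    1<n = ≤-trans (s≤s (s≤s z≤n)) 4≤n

    n≢2 : n ≢ 2
    n≢2 = n≢ (s≤s (s≤s (s≤s z≤n)))

    n≢3 : n ≢ 3
    n≢3 = n≢ (s≤s (s≤s (s≤s (s≤s z≤n))))

    C-E : ∀ p q → C p q ≡ true → dist p q ≡ 1
    C-E p q e = ≡ᵇ⇒≡ (dist p q) 1 (Equivalence.from T-≡ e)

    C-I : ∀ p q → dist p q ≡ 1 → C p q ≡ true
    C-I p q e = Equivalence.to T-≡ (≡⇒≡ᵇ (dist p q) 1 e)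

    C-F : ∀ p q → dist p q ≢ 1 → C p q ≡ false
    C-F p q d≢1 = ¬true⇒false (λ e → d≢1 (C-E p q e))

  -- C is admissible; the interval condition holds vacuously, since a clockwise
  -- triple p q r would have 0 < d(p,q) < d(p,r) = 1
  C-admissible : Admissible C
  C-admissible = loopless , two-free , circular
    where
    loopless : Loopless C
    loopless x e = n≢1 (trans (sym (dist-self x)) (C-E x x e))
    two-free : TwoFree C
    two-free w x w≢x (e₁ , e₂) =
      n≢2 (trans (sym (dist-sum w≢x)) (cong₂ _+_ (C-E w x e₁) (C-E x w e₂)))
    circular : CircularInterval C
    circular p q r c e =
      ⊥-elim (<⇒≱ (subst (dist p q <_) (C-E p r e) (clockwise-<₁ c)) (dist-pos p q))

  consecutive-triple : ∀ p → tri C p (next p) (next (next p)) ≡ true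
  consecutive-triple p = tri-I C record
    { p≢w = next-≢ 1<n p ; w≢q = next-≢ 1<n w ; p≢q = p≢q
    ; pw = C-I p w (dist-next p) ; wq = C-I w q (dist-next w)
    ; ¬pq = C-F p q pq≢1 ; ¬qp = C-F q p qp≢1 }
    where
    w q : Fin n
    w = next p
    q = next w
    p≢q : p ≢ q
    p≢q p≡q = n≢2 (trans (sym (dist-sum (next-≢ 1<n p)))
      (cong₂ _+_ (dist-next p) (trans (cong (dist w) p≡q) (dist-next w))))
    pq≢1 : dist p q ≢ 1
    pq≢1 e = next-≢ 1<n w (sym (dist-1⇒next p q e))
    -- p, w, q are clockwise (so d(p,q) = 2 and d(q,p) = n - 2), the other order is impossible
    qp≢1 : dist q p ≢ 1
    qp≢1 e with clockwise-either (next-≢ 1<n p) (next-≢ 1<n w) p≢q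
    ... | inj₁ c = n≢3 (trans (sym (dist-sum p≢q))
      (cong₂ _+_ (trans (sym (dist-add c)) (cong₂ _+_ (dist-next p) (dist-next w))) e))
    ... | inj₂ c = <⇒≱ (subst (dist p q <_) (dist-next p) (clockwise-<₁ c)) (dist-pos p q)

  P3-cycle : n ≤ P3 C
  P3-cycle = subst (_≤ P3 C) (sum-one {n}) (sum-mono (λ p →
    ≤-trans (count-≥1 (tri C p (next p)) (next (next p)) (consecutive-triple p))
            (sum-≥ (λ w → count (tri C p w)) (next p))))

module ShortEdges {n : ℕ} (G : Digraph n) (short : ∀ p q → Edge G p q → dist p q ≤ 1) where
  edge-to-next : ∀ p q → Edge G p q → q ≡ next p
  edge-to-next p q e = dist-1⇒next p q (≤-antisym (short p q e) (dist-pos p q))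

  -- every triple starting at p is (p , next p , next (next p))
  triples-from : ∀ p → sumFin (λ w → count (tri G p w)) ≤ 1
  triples-from p = ≤-trans (sum-mono through) (≤-reflexive (sum-point (next p) (λ _ → 1)))
    where
    through : ∀ w → count (tri G p w) ≤ (if w == next p then 1 else 0)
    through w with w F.≟ next p
    ... | yes _ = ≤-trans
      (count-mono (λ q t → dec-true (q F.≟ next w) (edge-to-next w q (Triple.wq (tri-E G p w q t)))))
      (≤-reflexive (trans (count≡sum (λ q → q == next w)) (sum-point (next w) (λ _ → 1))))
    ... | no w≢next = ≤-reflexive (count-zero (tri G p w) (λ q → ¬true⇒false λ t →
      w≢next (edge-to-next p w (Triple.pw (tri-E G p w q t)))))

  P3-short : (v : Fin n) → (∀ y → G v y ≡ false) → P3 G < n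
  P3-short v sink = subst (P3 G <_) (sum-one {n})
    (sum-strict triples-from v (subst (_< 1) (sym none-from-v) z<s))
    where
    none-from-v : sumFin (λ w → count (tri G v w)) ≡ 0
    none-from-v = trans (sum-cong (λ w → count-zero (tri G v w) (λ q → ¬true⇒false λ t →
      clash (Triple.pw (tri-E G v w q t)) (sink w)))) (sum-zero {n})

module ShortestNonEdge {n : ℕ} (G : Digraph n) (adm : Admissible G) (u v : Fin n)
                       (mn : MinNonEdge G u v) where
  loopless : ∀ x → G x x ≡ false
  loopless x = ¬true⇒false (proj₁ adm x)

  circular : CircularInterval G
  circular = proj₂ (proj₂ adm)

  α : ℕ
  α = dist u v

  u≢v : u ≢ v
  u≢v = proj₁ (nonEdge-E G (proj₁ mn))

  ¬uv : G u v ≡ false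
  ¬uv = proj₁ (proj₂ (nonEdge-E G (proj₁ mn)))

  ¬vu : G v u ≡ false
  ¬vu = proj₂ (proj₂ (nonEdge-E G (proj₁ mn)))

  adjacent : (w x : Fin n) → w ≢ x → dist w x < α → G w x ≡ true ⊎ G x w ≡ true
  adjacent w x w≢x short with G w x in e₁ | G x w in e₂
  ... | true | _ = inj₁ refl
  ... | false | true = inj₂ refl
  ... | false | false = ⊥-elim (<⇒≱ short (proj₂ mn w x (nonEdge-I G w≢x e₁ e₂)))

  -- vu is a non-edge too, so 2α ≤ d(u,v) + d(v,u) = n
  2α≤n : α + α ≤ n
  2α≤n = subst (α + α ≤_) (dist-sum u≢v)
    (+-monoʳ-≤ α (proj₂ mn v u (nonEdge-I G (λ e → u≢v (sym e)) ¬vu ¬uv)))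

  complement-long : ∀ x y → x + y ≡ n → y < α → α < x
  complement-long x y x+y≡n y<α = +-cancelʳ-< y α x (begin-strict
    α + y <⟨ +-monoʳ-< α y<α ⟩
    α + α ≤⟨ 2α≤n ⟩
    n     ≡⟨ sym x+y≡n ⟩
    x + y ∎)
    where open ≤-Reasoning

  -- if v is a sink and α ≥ 2, the successor s of v is adjacent to v,
  -- so sv is an edge, of length n - 1 > α
  sink-long-edge : (∀ y → G v y ≡ false) → 2 ≤ α →
    ∃ λ p → ∃ λ q → G p q ≡ true × α < dist p q
  sink-long-edge sink 2≤α = long (adjacent v (next v) v≢s vs<α)
    where
    vs<α : dist v (next v) < α
    vs<α = subst (_< α) (sym (dist-next v)) 2≤α
    v≢s : v ≢ next v
    v≢s = next-≢ (≤-trans 2≤α (dist-≤ u v)) v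
    long : G v (next v) ≡ true ⊎ G (next v) v ≡ true →
      ∃ λ p → ∃ λ q → G p q ≡ true × α < dist p q
    long (inj₁ vs) = clash vs (sink (next v))
    long (inj₂ sv) = next v , v , sv ,
      complement-long (dist (next v) v) (dist v (next v)) (dist-sum (λ e → v≢s (sym e))) vs<α

  module AddEdge (no-path : ∀ x → ¬ (Edge G v x × Edge G x u)) where
    -- H = G + uv, used only through the four facts below
    opaque
      H : Digraph n
      H w x = G w x ∨ ((w == u) ∧ (x == v))

    opaque
      unfolding H

      H-⊇ : {w x : Fin n} → G w x ≡ true → H w x ≡ true
      H-⊇ e rewrite e = refl

      H-uv : H u v ≡ true
      H-uv rewrite ¬uv | ==-refl u | ==-refl v = refl

      H-edge : {w x : Fin n} → H w x ≡ true → G w x ≡ true ⊎ (w ≡ u × x ≡ v)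
      H-edge {w} {x} e with G w x | w F.≟ u | x F.≟ v
      ... | true  | _         | _         = inj₁ refl
      ... | false | yes w≡u   | yes x≡v   = inj₂ (w≡u , x≡v)
      ... | false | no _      | _         = ⊥-elim (t≢f (sym e))
      ... | false | yes _     | no _      = ⊥-elim (t≢f (sym e))

      H-elsewhere : {w x : Fin n} → ¬ (w ≡ u × x ≡ v) → H w x ≡ G w x
      H-elsewhere {w} {x} not-uv with w F.≟ u | x F.≟ v
      ... | yes w≡u | yes x≡v = ⊥-elim (not-uv (w≡u , x≡v))
      ... | no _    | _       = ∨-identityʳ (G w x)
      ... | yes _   | no _    = ∨-identityʳ (G w x)

    H-false : {w x : Fin n} → H w x ≡ false → G w x ≡ false
    H-false e = ¬true⇒false (λ g → clash (H-⊇ g) e)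

    -- H is admissible: the only new edge uv spans only vertices q with
    -- d(u,q), d(q,v) < α, which are adjacent to u and v in the right direction
    H-admissible : Admissible H
    H-admissible = H-loopless , H-two-free , H-circular
      where
      H-loopless : Loopless H
      H-loopless x e with H-edge e
      ... | inj₁ g = clash g (loopless x)
      ... | inj₂ (refl , x≡v) = u≢v x≡v

      H-two-free : TwoFree H
      H-two-free w x w≢x (e₁ , e₂) with H-edge e₁ | H-edge e₂
      ... | inj₁ g₁ | inj₁ g₂ = proj₁ (proj₂ adm) w x w≢x (g₁ , g₂)
      ... | inj₁ g₁ | inj₂ (refl , refl) = clash g₁ ¬vu
      ... | inj₂ (refl , refl) | inj₁ g₂ = clash g₂ ¬vu
      ... | inj₂ (refl , refl) | inj₂ (v≡u , _) = u≢v (sym v≡u)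

      H-circular : CircularInterval H
      H-circular p q r c e with H-edge e
      ... | inj₁ g = let (g₁ , g₂) = circular p q r c g in H-⊇ g₁ , H-⊇ g₂
      ... | inj₂ (refl , refl) = H-⊇ uq , H-⊇ qv
        where
        uq : G u q ≡ true
        uq with adjacent u q (clockwise-≢₁ c) (clockwise-<₁ c)
        ... | inj₁ g = g
        ... | inj₂ g = clash (proj₂ (circular q v u (clockwise-rotate c) g)) ¬vu
        qv : G q v ≡ true
        qv with adjacent q v (clockwise-≢₂ c) (clockwise-<₂ c)
        ... | inj₁ g = g
        ... | inj₂ g = clash (proj₁ (circular v u q (clockwise-rotate (clockwise-rotate c)) g)) ¬vu

    -- in-neighbours p of u non-adjacent to v: (p , u , v) is a new triple of H
    inGain : Fin n → Bool
    inGain p = G p u ∧ not (G p v) ∧ not (G v p)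

    -- out-neighbours q of v non-adjacent to u: (u , v , q) is a new triple of H
    outGain : Fin n → Bool
    outGain q = G v q ∧ not (G u q) ∧ not (G q u)

    -- middles w of the triples (u , w , v) of G, destroyed in H
    lost : Fin n → Bool
    lost w = tri G u w v

    gainedIn gainedOut lostAt : Fin n → Fin n → Fin n → Bool
    gainedIn p w q = (w == u) ∧ (q == v) ∧ inGain p
    gainedOut p w q = (p == u) ∧ (w == v) ∧ outGain q
    lostAt p w q = (p == u) ∧ (q == v) ∧ tri G p w q

    -- a triple of G other than (u , w , v) survives in H; the reverse
    -- (v , w , u) is not a triple since there is no 2-path v → w → u
    kept : ∀ p w q → tri G p w q ≡ true → lostAt p w q ≡ false → tri H p w q ≡ true
    kept p w q t l = tri-I H record
      { p≢w = p≢w ; w≢q = w≢q ; p≢q = p≢q ; pw = H-⊇ pw ; wq = H-⊇ wq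
      ; ¬pq = trans (H-elsewhere not-uv) ¬pq ; ¬qp = trans (H-elsewhere not-vu) ¬qp }
      where
      open Triple (tri-E G p w q t)
      not-uv : ¬ (p ≡ u × q ≡ v)
      not-uv (refl , refl) = clash (∧-I (==-refl u) (∧-I (==-refl v) t)) l
      not-vu : ¬ (q ≡ u × p ≡ v)
      not-vu (refl , refl) = no-path w (pw , wq)

    created-in : ∀ p w q → gainedIn p w q ≡ true → tri H p w q ≡ true
    created-in p w q g with located w u q v (inGain p) g
    ... | refl , refl , i = tri-I H record
      { p≢w = λ { refl → clash pu (loopless u) } ; w≢q = u≢v ; p≢q = λ { refl → clash pu ¬vu }
      ; pw = H-⊇ pu ; wq = H-uv
      ; ¬pq = trans (H-elsewhere (λ { (refl , _) → clash pu (loopless u) })) (not-E ¬pv)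
      ; ¬qp = trans (H-elsewhere (λ (v≡u , _) → u≢v (sym v≡u))) (not-E ¬vp) }
      where
      pu : G p u ≡ true
      pu = proj₁ (∧-E (G p u) i)
      ¬pv : not (G p v) ≡ true
      ¬pv = proj₁ (∧-E (not (G p v)) (proj₂ (∧-E (G p u) i)))
      ¬vp : not (G v p) ≡ true
      ¬vp = proj₂ (∧-E (not (G p v)) (proj₂ (∧-E (G p u) i)))

    created-out : ∀ p w q → gainedOut p w q ≡ true → tri H p w q ≡ true
    created-out p w q g with located p u w v (outGain q) g
    ... | refl , refl , o = tri-I H record
      { p≢w = u≢v ; w≢q = λ { refl → clash vq (loopless v) } ; p≢q = λ { refl → clash vq ¬vu }
      ; pw = H-uv ; wq = H-⊇ vq
      ; ¬pq = trans (H-elsewhere (λ { (_ , refl) → clash vq (loopless v) })) (not-E ¬uq)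
      ; ¬qp = trans (H-elsewhere (λ { (refl , _) → clash vq ¬vu })) (not-E ¬qu) }
      where
      vq : G v q ≡ true
      vq = proj₁ (∧-E (G v q) o)
      ¬uq : not (G u q) ≡ true
      ¬uq = proj₁ (∧-E (not (G u q)) (proj₂ (∧-E (G v q) o)))
      ¬qu : not (G q u) ≡ true
      ¬qu = proj₂ (∧-E (not (G u q)) (proj₂ (∧-E (G v q) o)))

    -- the three kinds are exclusive: old triples never contain the step u → v
    old-not-in : ∀ p w q → tri G p w q ≡ true → gainedIn p w q ≡ false
    old-not-in p w q t = ¬true⇒false λ g →
      let (w≡u , q≡v , _) = located w u q v (inGain p) g
      in clash (subst₂ (λ a b → G a b ≡ true) w≡u q≡v (Triple.wq (tri-E G p w q t))) ¬uv

    old-not-out : ∀ p w q → tri G p w q ≡ true → gainedOut p w q ≡ false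
    old-not-out p w q t = ¬true⇒false λ g →
      let (p≡u , w≡v , _) = located p u w v (outGain q) g
      in clash (subst₂ (λ a b → G a b ≡ true) p≡u w≡v (Triple.pw (tri-E G p w q t))) ¬uv

    in-not-out : ∀ p w q → gainedIn p w q ≡ true → gainedOut p w q ≡ false
    in-not-out p w q g = ¬true⇒false λ g′ →
      u≢v (trans (sym (proj₁ (located w u q v (inGain p) g)))
                 (proj₁ (proj₂ (located p u w v (outGain q) g′))))

    triple-exchange : ∀ p w q →
      ind (tri G p w q) + ind (gainedIn p w q) + ind (gainedOut p w q) ≤
      ind (tri H p w q) + ind (lostAt p w q)
    triple-exchange p w q = exchange _ _ _ _ _ (kept p w q) (created-in p w q)
      (created-out p w q) (old-not-in p w q) (old-not-out p w q) (in-not-out p w q)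

    sum-lostAt : sum3 (λ p w q → ind (lostAt p w q)) ≡ count lost
    sum-lostAt = begin
      sum3 (λ p w q → ind ((p == u) ∧ (q == v) ∧ tri G p w q))
        ≡⟨ sum-cong (λ p → sum-cong (λ w → sum-guarded (p == u) (λ q → (q == v) ∧ tri G p w q))) ⟩
      sumFin (λ p → sumFin (λ w → if p == u then sumFin (λ q → ind ((q == v) ∧ tri G p w q)) else 0))
        ≡⟨ sum-cong (λ p → sum-cong (λ w → guard-cong (p == u) (sum-at v (tri G p w)))) ⟩
      sumFin (λ p → sumFin (λ w → if p == u then ind (tri G p w v) else 0))
        ≡⟨ sum-cong (λ p → sum-guard (p == u) (λ w → ind (tri G p w v))) ⟩
      sumFin (λ p → if p == u then sumFin (λ w → ind (tri G p w v)) else 0)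
        ≡⟨ sum-point u (λ p → sumFin (λ w → ind (tri G p w v))) ⟩
      sumFin (λ w → ind (lost w))
        ≡⟨ sym (count≡sum lost) ⟩
      count lost ∎
      where open ≡-Reasoning

    sum-gainedIn : sum3 (λ p w q → ind (gainedIn p w q)) ≡ count inGain
    sum-gainedIn = begin
      sum3 (λ p w q → ind ((w == u) ∧ (q == v) ∧ inGain p))
        ≡⟨ sum-cong (λ p → sum-cong (λ w → sum-guarded (w == u) (λ q → (q == v) ∧ inGain p))) ⟩
      sumFin (λ p → sumFin (λ w → if w == u then sumFin (λ q → ind ((q == v) ∧ inGain p)) else 0))
        ≡⟨ sum-cong (λ p → sum-cong (λ w → guard-cong (w == u) (sum-at v (λ _ → inGain p)))) ⟩
      sumFin (λ p → sumFin (λ w → if w == u then ind (inGain p) else 0))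
        ≡⟨ sum-cong (λ p → sum-point u (λ _ → ind (inGain p))) ⟩
      sumFin (λ p → ind (inGain p))
        ≡⟨ sym (count≡sum inGain) ⟩
      count inGain ∎
      where open ≡-Reasoning

    sum-gainedOut : sum3 (λ p w q → ind (gainedOut p w q)) ≡ count outGain
    sum-gainedOut = begin
      sum3 (λ p w q → ind ((p == u) ∧ (w == v) ∧ outGain q))
        ≡⟨ sum-cong (λ p → sum-cong (λ w → sum-guarded (p == u) (λ q → (w == v) ∧ outGain q))) ⟩
      sumFin (λ p → sumFin (λ w → if p == u then sumFin (λ q → ind ((w == v) ∧ outGain q)) else 0))
        ≡⟨ sum-cong (λ p → sum-cong (λ w → guard-cong (p == u) (sum-guarded (w == v) outGain))) ⟩
      sumFin (λ p → sumFin (λ w → if p == u then (if w == v then K else 0) else 0))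
        ≡⟨ sum-cong (λ p → sum-guard (p == u) (λ w → if w == v then K else 0)) ⟩
      sumFin (λ p → if p == u then sumFin (λ w → if w == v then K else 0) else 0)
        ≡⟨ sum-cong (λ p → guard-cong (p == u) (sum-point v (λ _ → K))) ⟩
      sumFin (λ p → if p == u then K else 0)
        ≡⟨ sum-point u (λ _ → K) ⟩
      K
        ≡⟨ sym (count≡sum outGain) ⟩
      count outGain ∎
      where
      open ≡-Reasoning
      K : ℕ
      K = sumFin (λ q → ind (outGain q))

    P3-accounting : P3 G + count inGain + count outGain ≤ P3 H + count lost
    P3-accounting = begin
      P3 G + count inGain + count outGain
        ≡⟨ cong₂ (λ x y → x + y + count outGain) (P3-as-sum3 G) (sym sum-gainedIn) ⟩
      sum3 old + sum3 new-in + count outGain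
        ≡⟨ cong (sum3 old + sum3 new-in +_) (sym sum-gainedOut) ⟩
      sum3 old + sum3 new-in + sum3 new-out
        ≡⟨ cong (_+ sum3 new-out) (sym (sum3-+ old new-in)) ⟩
      sum3 (λ p w q → old p w q + new-in p w q) + sum3 new-out
        ≡⟨ sym (sum3-+ (λ p w q → old p w q + new-in p w q) new-out) ⟩
      sum3 (λ p w q → old p w q + new-in p w q + new-out p w q)
        ≤⟨ sum3-mono triple-exchange ⟩
      sum3 (λ p w q → ind (tri H p w q) + ind (lostAt p w q))
        ≡⟨ sum3-+ (λ p w q → ind (tri H p w q)) (λ p w q → ind (lostAt p w q)) ⟩
      sum3 (λ p w q → ind (tri H p w q)) + sum3 (λ p w q → ind (lostAt p w q))
        ≡⟨ cong₂ _+_ (sym (P3-as-sum3 H)) sum-lostAt ⟩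
      P3 H + count lost ∎
      where
      open ≤-Reasoning
      old new-in new-out : Fin n → Fin n → Fin n → ℕ
      old p w q = ind (tri G p w q)
      new-in p w q = ind (gainedIn p w q)
      new-out p w q = ind (gainedOut p w q)

    lost-between : ∀ x → lost x ≡ true → Clockwise u x v
    lost-between x t = orient (clockwise-either p≢w w≢q u≢v)
      where
      open Triple (tri-E G u x v t)
      orient : Clockwise u x v ⊎ Clockwise u v x → Clockwise u x v
      orient (inj₁ c) = c
      orient (inj₂ c) = clash (proj₁ (circular u v x c pw)) ¬uv

    -- every y ≠ u with d(y,u) < α lies beyond v, hence y → u and y ≁ v
    inGain-near : ∀ y → y ≢ u → dist y u < α → inGain y ≡ true
    inGain-near y y≢u y→u<α = ∧-I yu (∧-I (not-I ¬yv) (not-I ¬vy))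
      where
      y→u-complement : α < dist u y
      y→u-complement = complement-long (dist u y) (dist y u) (dist-sum (λ e → y≢u (sym e))) y→u<α
      v≢y : v ≢ y
      v≢y refl = <-irrefl refl (complement-long α (dist v u) (dist-sum u≢v) y→u<α)
      beyond : Clockwise u v y
      beyond with clockwise-either u≢v v≢y (λ e → y≢u (sym e))
      ... | inj₁ c = c
      ... | inj₂ c = ⊥-elim (<⇒≱ (clockwise-<₁ c) (<⇒≤ y→u-complement))
      yu : G y u ≡ true
      yu with adjacent y u y≢u y→u<α
      ... | inj₁ g = g
      ... | inj₂ g = clash (proj₁ (circular u v y beyond g)) ¬uv
      ¬yv : G y v ≡ false
      ¬yv = ¬true⇒false λ g →
        clash (proj₂ (circular y u v (clockwise-rotate (clockwise-rotate beyond)) g)) ¬uv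
      ¬vy : G v y ≡ false
      ¬vy = ¬true⇒false λ g → no-path y (g , yu)

    -- reflecting in u maps the destroyed middles injectively into inGain
    lost≤inGain : count lost ≤ count inGain
    lost≤inGain = begin
      count lost                              ≡⟨ count≡sum lost ⟩
      sumFin (λ x → ind (lost x))             ≤⟨ sum-mono (λ x → ind-mono (reflected x)) ⟩
      sumFin (λ x → ind (inGain (reflect x)))
        ≡⟨ sym (sum-involution reflect reflect-involutive (λ y → ind (inGain y))) ⟩
      sumFin (λ y → ind (inGain y))           ≡⟨ sym (count≡sum inGain) ⟩
      count inGain                            ∎
      where
      open ≤-Reasoning
      open Reflection u
      reflected : ∀ x → lost x ≡ true → inGain (reflect x) ≡ true
      reflected x t = inGain-near (reflect x) (reflect-≢ x x≢u)
        (subst (_< α) (sym (dist-to-reflect x x≢u)) (clockwise-<₁ (lost-between x t)))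
        where
        x≢u : x ≢ u
        x≢u e = Triple.p≢w (tri-E G u x v t) (sym e)

    P3-gain : P3 G + count outGain ≤ P3 H
    P3-gain = +-cancelʳ-≤ (count lost) _ _ (begin
      P3 G + count outGain + count lost   ≤⟨ +-monoʳ-≤ (P3 G + count outGain) lost≤inGain ⟩
      P3 G + count outGain + count inGain ≡⟨ xy∙z≈xz∙y (P3 G) _ _ ⟩
      P3 G + count inGain + count outGain ≤⟨ P3-accounting ⟩
      P3 H + count lost                   ∎)
      where open ≤-Reasoning

    P3-≤ : P3 G ≤ P3 H
    P3-≤ = ≤-trans (m≤m+n (P3 G) _) P3-gain

    -- an out-neighbour y of v is not adjacent to u, so H gains (u , v , y)
    P3-< : ∀ y → G v y ≡ true → P3 G < P3 H
    P3-< y vy = ≤-trans (subst (_≤ P3 G + count outGain) (+-comm (P3 G) 1)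
      (+-monoʳ-≤ (P3 G) (count-≥1 outGain y (∧-I vy (∧-I (not-I ¬uy) (not-I ¬yu)))))) P3-gain
      where
      ¬uy : G u y ≡ false
      ¬uy = ¬true⇒false λ uy →
        [ (λ c → clash (proj₁ (circular u v y c uy)) ¬uv)
        , (λ c → clash (proj₁ (circular v u y (clockwise-rotate (clockwise-rotate c)) vy)) ¬vu) ]′
        (clockwise-either u≢v (λ { refl → clash vy (loopless v) }) (λ { refl → clash vy ¬vu }))
      ¬yu : G y u ≡ false
      ¬yu = ¬true⇒false λ yu → no-path y (vy , yu)

    -- ξ(H) counts a subset of the pairs counted by ξ(G), missing (pq , uv)
    -- for every edge pq longer than α
    xi-< : ∀ p q → G p q ≡ true → α < dist p q → xi H < xi G
    xi-< p q pq long = count4-strict longer-H⇒G p q u v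
      (¬true⇒false uv-uncounted-in-H) (∧-I pq (∧-I (proj₁ mn) (<ᵇ-true long)))
      where
      uv-uncounted-in-H : longer H p q u v ≡ true → ⊥
      uv-uncounted-in-H t =
        clash H-uv (proj₁ (proj₂ (nonEdge-E H {u} {v} (proj₁ (∧-E _ (proj₂ (∧-E (H p q) t)))))))
      longer-H⇒G : ∀ p q w x → longer H p q w x ≡ true → longer G p q w x ≡ true
      longer-H⇒G p q w x t = ∧-I pq-in-G (∧-I nonEdge-G shorter)
        where
        pq-in-H : H p q ≡ true
        pq-in-H = proj₁ (∧-E (H p q) t)
        nonEdge-H : NonEdge H w x
        nonEdge-H = proj₁ (∧-E (nonEdgeᵇ H w x) (proj₂ (∧-E (H p q) t)))
        shorter : (dist w x <ᵇ dist p q) ≡ true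
        shorter = proj₂ (∧-E (nonEdgeᵇ H w x) (proj₂ (∧-E (H p q) t)))
        nonEdge-G : NonEdge G w x
        nonEdge-G = let (w≢x , ¬wx , ¬xw) = nonEdge-E H {w} {x} nonEdge-H
                    in nonEdge-I G {w} {x} w≢x (H-false ¬wx) (H-false ¬xw)
        -- the new edge uv is not longer than any non-edge, by minimality of α
        pq-in-G : G p q ≡ true
        pq-in-G with H-edge pq-in-H
        ... | inj₁ g = g
        ... | inj₂ (refl , refl) =
          ⊥-elim (<⇒≱ (<ᵇ⇒< (dist w x) α (Equivalence.from T-≡ shorter)) (proj₂ mn w x nonEdge-G))

lemma3p7 : (n : ℕ) → 4 ≤ n → (G : Digraph n) → Optimal G →
    (u v : Fin n) → MinNonEdge G u v →
    ∃ λ x → Edge G v x × Edge G x u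
lemma3p7 n 4≤n G opt u v mn with FP.any? (λ x → (G v x B.≟ true) ×-dec (G x u B.≟ true))
... | yes path = path
... | no no-path = ⊥-elim absurd
  where
  open ShortestNonEdge G (proj₁ opt) u v mn
  open AddEdge (λ x p → no-path (x , p))
  open Cycle n 4≤n using (C; C-admissible; P3-cycle)

  absurd : ⊥
  -- (1) an out-neighbour y of v would give P̃₃(H) > P̃₃(G)
  absurd with FP.any? (λ y → G v y B.≟ true)
  ... | yes (y , vy) = <⇒≱ (P3-< y vy) (P3-maximal opt H H-admissible)
  -- (2) an edge longer than α would give P̃₃(H) = P̃₃(G) but ξ(H) < ξ(G)
  ... | no has-out with FP.any? (λ p → FP.any? (λ q → (G p q B.≟ true) ×-dec (α <? dist p q)))
  ... | yes (p , q , pq , long) = <⇒≱ (xi-< p q pq long)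
        (xi-minimal opt H H-admissible (≤-antisym (P3-maximal opt H H-admissible) P3-≤))
  -- (3) otherwise α ≤ 1, all edges have length ≤ 1 and P̃₃(G) < n ≤ P̃₃(C)
  ... | no no-long = <⇒≱ (ShortEdges.P3-short G short v sink)
        (≤-trans P3-cycle (P3-maximal opt C C-admissible))
    where
    sink : ∀ y → G v y ≡ false
    sink y = ¬true⇒false λ vy → has-out (y , vy)
    α≤1 : α ≤ 1
    α≤1 = ≮⇒≥ λ 1<α → no-long (sink-long-edge sink 1<α)
    short : ∀ p q → Edge G p q → dist p q ≤ 1
    short p q pq = ≤-trans (≮⇒≥ λ long → no-long (p , q , pq , long)) α≤1
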